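{- Let $\Gamma$ be an ordered abelian group and $\gamma\in\Gamma$ with $\gamma>0$. The following are equivalent: (i) $\Gamma$ is regular above $\gamma$; (ii) $\Gamma/\mathrm{Conv}(\gamma)$ is divisible; (iii) $\Gamma^*/\mathrm{Conv}(\gamma)$ is divisible for every elementary extension $(\Gamma^*,\gamma)\succcurlyeq(\Gamma,\gamma)$, where $\mathrm{Conv}(\gamma)$ denotes the convex hull of $\gamma$ in $\Gamma^*$.
   Context: $\Gamma$ is regular above $\gamma$ if for every integer $n>1$: for all $x>n\gamma$ there exist $y,z\in\Gamma$ with $x=ny+z$ and $0\le z<n\gamma$. $\mathrm{Conv}(\gamma)=\{\delta : |\delta|\le n\gamma\text{ for some } n\in\mathbb{N}\}$ is the smallest convex subgroup containing $\gamma$. Elementary extensions are taken in the language of ordered abelian groups $\{0,+,-,\le\}$ expanded by a constant for $\gamma$. -}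

module Defs where

open import Level using (Level; _⊔_; Lift; lift; Setω) renaming (suc to lsuc)
open import Data.Nat using (ℕ; zero; suc)
open import Data.Fin using (Fin; zero; suc)
open import Data.Product using (Σ; _×_; ∃; _,_)
open import Data.Sum using (_⊎_)
open import Data.Empty.Polymorphic using (⊥)
open import Relation.Nullary using (¬_)
open import Relation.Binary using (Rel; IsTotalOrder)
open import Algebra.Structures using (IsAbelianGroup)
open import Function using (_∘_)

record OrderedAbelianGroup (c ℓ₁ ℓ₂ : Level) : Set (lsuc (c ⊔ ℓ₁ ⊔ ℓ₂)) where
  infix  4 _≈_ _≤_
  infixl 6 _+_ _-_
  infix  4 _<_
  infixr 7 _·_
  infix  8 -_
  field
    Carrier        : Set c
    _≈_            : Rel Carrier ℓ₁
    _+_            : Carrier → Carrier → Carrier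
    0#             : Carrier
    -_             : Carrier → Carrier
    _≤_            : Rel Carrier ℓ₂
    isAbelianGroup : IsAbelianGroup _≈_ _+_ 0# -_
    isTotalOrder   : IsTotalOrder _≈_ _≤_
    +-mono-≤       : ∀ {x y} z → x ≤ y → x + z ≤ y + z

  _<_ : Rel Carrier (ℓ₁ ⊔ ℓ₂)
  x < y = x ≤ y × ¬ (x ≈ y)

  _·_ : ℕ → Carrier → Carrier
  zero  · x = 0#
  suc n · x = x + n · x

  _-_ : Carrier → Carrier → Carrier
  x - y = x + (- y)

module _ {c ℓ₁ ℓ₂} (G : OrderedAbelianGroup c ℓ₁ ℓ₂) where
  open OrderedAbelianGroup G

  -- Conv(γ) = { δ : |δ| ≤ n·γ for some n ∈ ℕ }   (|δ| ≤ a  ⇔  δ ≤ a ∧ -δ ≤ a)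
  Conv : Carrier → Carrier → Set (ℓ₂)
  Conv γ δ = ∃ λ (n : ℕ) → (δ ≤ n · γ) × (- δ ≤ n · γ)

  RegularAbove : Carrier → Set (c ⊔ ℓ₁ ⊔ ℓ₂)
  RegularAbove γ = ∀ (n : ℕ) → 2 Data.Nat.≤ n → ∀ (x : Carrier) → n · γ < x →
    Σ Carrier λ y → Σ Carrier λ z → (x ≈ n · y + z) × (0# ≤ z) × (z < n · γ)

  -- Γ / Conv(γ) is divisible: for every class [x] and every n ≥ 1 there is
  -- a class [y] with n[y] = [x], i.e. x - n·y ∈ Conv(γ).
  DivisibleModConv : Carrier → Set (c ⊔ ℓ₂)
  DivisibleModConv γ = ∀ (n : ℕ) → 1 Data.Nat.≤ n → ∀ (x : Carrier) →
    Σ Carrier λ y → Conv γ (x - n · y)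

-- First-order language {0, +, -, ≤} of ordered abelian groups, expanded by
-- a constant symbol c (interpreted as γ); equality is part of the logic.

data Term (k : ℕ) : Set where
  var  : Fin k → Term k
  zer  : Term k
  cst  : Term k
  _⊕_  : Term k → Term k → Term k
  ⊖_   : Term k → Term k

data Formula : ℕ → Set where
  _≐_  : ∀ {k} → Term k → Term k → Formula k
  _≼_  : ∀ {k} → Term k → Term k → Formula k
  ⊥f   : ∀ {k} → Formula k
  _∧f_ : ∀ {k} → Formula k → Formula k → Formula k
  _∨f_ : ∀ {k} → Formula k → Formula k → Formula k
  _⇒f_ : ∀ {k} → Formula k → Formula k → Formula k
  ∃f   : ∀ {k} → Formula (suc k) → Formula k
  ∀f   : ∀ {k} → Formula (suc k) → Formula k

extend : ∀ {a} {A : Set a} {k} → A → (Fin k → A) → Fin (suc k) → A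
extend a ρ zero    = a
extend a ρ (suc i) = ρ i

module _ {c ℓ₁ ℓ₂} (G : OrderedAbelianGroup c ℓ₁ ℓ₂) (γ : OrderedAbelianGroup.Carrier G) where
  open OrderedAbelianGroup G

  ⟦_⟧t : ∀ {k} → Term k → (Fin k → Carrier) → Carrier
  ⟦ var i ⟧t ρ = ρ i
  ⟦ zer   ⟧t ρ = 0#
  ⟦ cst   ⟧t ρ = γ
  ⟦ s ⊕ t ⟧t ρ = ⟦ s ⟧t ρ + ⟦ t ⟧t ρ
  ⟦ ⊖ t   ⟧t ρ = - ⟦ t ⟧t ρ

  Sat : ∀ {k} → Formula k → (Fin k → Carrier) → Set (c ⊔ ℓ₁ ⊔ ℓ₂)
  Sat (s ≐ t)  ρ = Lift (c ⊔ ℓ₂) (⟦ s ⟧t ρ ≈ ⟦ t ⟧t ρ)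
  Sat (s ≼ t)  ρ = Lift (c ⊔ ℓ₁) (⟦ s ⟧t ρ ≤ ⟦ t ⟧t ρ)
  Sat ⊥f       ρ = ⊥
  Sat (φ ∧f ψ) ρ = Sat φ ρ × Sat ψ ρ
  Sat (φ ∨f ψ) ρ = Sat φ ρ ⊎ Sat ψ ρ
  Sat (φ ⇒f ψ) ρ = Sat φ ρ → Sat ψ ρ
  Sat (∃f φ)   ρ = Σ Carrier λ a → Sat φ (extend a ρ)
  Sat (∀f φ)   ρ = ∀ (a : Carrier) → Sat φ (extend a ρ)

record ElementaryExtension {c ℓ₁ ℓ₂ c' ℓ₁' ℓ₂'}
    (G : OrderedAbelianGroup c ℓ₁ ℓ₂) (γ : OrderedAbelianGroup.Carrier G)
    (G* : OrderedAbelianGroup c' ℓ₁' ℓ₂') (γ* : OrderedAbelianGroup.Carrier G*)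
    : Set (c ⊔ ℓ₁ ⊔ ℓ₂ ⊔ c' ⊔ ℓ₁' ⊔ ℓ₂') where
  field
    embed    : OrderedAbelianGroup.Carrier G → OrderedAbelianGroup.Carrier G*
    preserve : ∀ {k} (φ : Formula k) (ρ : Fin k → OrderedAbelianGroup.Carrier G) →
               Sat G γ φ ρ → Sat G* γ* φ (embed ∘ ρ)
    reflect  : ∀ {k} (φ : Formula k) (ρ : Fin k → OrderedAbelianGroup.Carrier G) →
               Sat G* γ* φ (embed ∘ ρ) → Sat G γ φ ρ

AllElemExtDivisible : ∀ {c ℓ₁ ℓ₂} (G : OrderedAbelianGroup c ℓ₁ ℓ₂) →
                      OrderedAbelianGroup.Carrier G → Setω
AllElemExtDivisible G γ =
  ∀ {c' ℓ₁' ℓ₂'} (G* : OrderedAbelianGroup c' ℓ₁' ℓ₂')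
  (γ* : OrderedAbelianGroup.Carrier G*) →
  ElementaryExtension G γ G* γ* → DivisibleModConv G* γ*

record TFAE {a b} (A : Set a) (B : Set b) (C : Setω) : Setω where
  field
    i⇒ii   : A → B
    ii⇒i   : B → A
    ii⇒iii : B → C
    iii⇒ii : C → B

{-# OPTIONS --safe #-}
-- Divisibility of Γ/Conv(γ) by n says that every coset x + nΓ meets Conv(γ). Euclidean division
-- by n·γ inside Conv(γ) moves the meeting point into [0, nγ], and γ > 0 lets a remainder z in
-- [(n-1)γ, nγ] be traded for (n-1)·(γ - e) with e = z - (n-1)γ, which gives regularity. Conversely,
-- regularity applied to x + (n+1)γ puts x - n·y into Conv(γ) whenever x ≥ 0.
-- Divisibility modulo Conv(γ) is not first-order, but (for γ ≥ 0) it is equivalent to the sentences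
-- ∀x ∃y ∃z (x = n·y + z ∧ 0 ≤ z ≤ n·γ), and these pass to every elementary extension.
module Submission where

open import Defs
open import Level using (Level; _⊔_; lift)
open import Data.Nat as ℕ using (ℕ; zero; suc; s≤s; z≤n)
open import Data.Fin using (Fin; zero; suc)
open import Data.Product using (Σ; _×_; _,_; proj₁; proj₂)
open import Data.Sum using (inj₁; inj₂)
open import Relation.Binary.PropositionalEquality using (_≡_; refl; cong)
open import Function using (_∘_; _⇔_; mk⇔; Equivalence)
open import Relation.Binary using (Poset; IsTotalOrder)
open import Algebra.Bundles using (AbelianGroup)

module OrderedAbelianGroupProperties {c ℓ₁ ℓ₂} (G : OrderedAbelianGroup c ℓ₁ ℓ₂) where
  open OrderedAbelianGroup G

  abelianGroup : AbelianGroup c ℓ₁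
  abelianGroup = record { isAbelianGroup = isAbelianGroup }

  open AbelianGroup abelianGroup public
    using (assoc; comm; identityˡ; identityʳ; inverseˡ; inverseʳ; ∙-congˡ; ∙-congʳ; ⁻¹-cong)
    renaming (refl to ≈-refl; sym to ≈-sym; trans to ≈-trans)
  open import Algebra.Properties.AbelianGroup abelianGroup public
    using (ε⁻¹≈ε; ⁻¹-involutive; ⁻¹-∙-comm; identityˡ-unique; xyx⁻¹≈y;
           \\-leftDividesʳ; //-rightDividesˡ; //-rightDividesʳ)
  open import Algebra.Properties.CommutativeSemigroup
    (AbelianGroup.commutativeSemigroup abelianGroup) public
    using (x∙yz≈y∙xz)
  open import Algebra.Properties.CommutativeMonoid.Mult
    (AbelianGroup.commutativeMonoid abelianGroup)
    using (×-distrib-+; ×-homo-+; ×-assocˡ; ×-congʳ) renaming (_×_ to _×ᴹ_)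

  poset : Poset c ℓ₁ ℓ₂
  poset = record { isPartialOrder = IsTotalOrder.isPartialOrder isTotalOrder }

  open IsTotalOrder isTotalOrder public
    using (total; ≤-respˡ-≈; ≤-respʳ-≈) renaming (refl to ≤-refl; trans to ≤-trans)
  open import Relation.Binary.Reasoning.PartialOrder poset public

  open import Relation.Binary.Properties.Poset poset public using (≤∧≉⇒<)

  x≈y+[x-y] : ∀ x y → x ≈ y + (x - y)
  x≈y+[x-y] x y = begin-equality
    x           ≈⟨ //-rightDividesˡ y x ⟨
    (x - y) + y ≈⟨ comm (x - y) y ⟩
    y + (x - y) ∎

  +-monoʳ-≤ : ∀ z {x y} → x ≤ y → z + x ≤ z + y
  +-monoʳ-≤ z {x} {y} x≤y = begin
    z + x ≈⟨ comm z x ⟩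
    x + z ≤⟨ +-mono-≤ z x≤y ⟩
    y + z ≈⟨ comm y z ⟩
    z + y ∎

  +-mono-≤₂ : ∀ {x y u v} → x ≤ y → u ≤ v → x + u ≤ y + v
  +-mono-≤₂ {y = y} {u} x≤y u≤v = ≤-trans (+-mono-≤ u x≤y) (+-monoʳ-≤ y u≤v)

  neg-mono-≤ : ∀ {x y} → x ≤ y → - y ≤ - x
  neg-mono-≤ {x} {y} x≤y = begin
    - y           ≈⟨ //-rightDividesʳ x (- y) ⟨
    (- y + x) - x ≤⟨ +-mono-≤ (- x) (+-monoʳ-≤ (- y) x≤y) ⟩
    (- y + y) - x ≈⟨ ∙-congʳ (inverseˡ y) ⟩
    0# - x        ≈⟨ identityˡ (- x) ⟩
    - x           ∎

  x≤0⇒0≤-x : ∀ {x} → x ≤ 0# → 0# ≤ - x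
  x≤0⇒0≤-x {x} x≤0 = begin
    0#   ≈⟨ ε⁻¹≈ε ⟨
    - 0# ≤⟨ neg-mono-≤ x≤0 ⟩
    - x  ∎

  0≤x⇒-x≤0 : ∀ {x} → 0# ≤ x → - x ≤ 0#
  0≤x⇒-x≤0 {x} 0≤x = begin
    - x  ≤⟨ neg-mono-≤ 0≤x ⟩
    - 0# ≈⟨ ε⁻¹≈ε ⟩
    0#   ∎

  x≤y⇒0≤y-x : ∀ {x y} → x ≤ y → 0# ≤ y - x
  x≤y⇒0≤y-x {x} {y} x≤y = begin
    0#    ≈⟨ inverseʳ x ⟨
    x - x ≤⟨ +-mono-≤ (- x) x≤y ⟩
    y - x ∎

  -x≤y⇒0≤x+y : ∀ {x y} → - x ≤ y → 0# ≤ x + y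
  -x≤y⇒0≤x+y {x} {y} -x≤y = begin
    0#    ≈⟨ inverseʳ x ⟨
    x - x ≤⟨ +-monoʳ-≤ x -x≤y ⟩
    x + y ∎

  x≤x+y : ∀ x {y} → 0# ≤ y → x ≤ x + y
  x≤x+y x {y} 0≤y = begin
    x      ≈⟨ identityʳ x ⟨
    x + 0# ≤⟨ +-monoʳ-≤ x 0≤y ⟩
    x + y  ∎

  x-y≤x : ∀ x {y} → 0# ≤ y → x - y ≤ x
  x-y≤x x {y} 0≤y = begin
    x - y  ≤⟨ +-monoʳ-≤ x (0≤x⇒-x≤0 0≤y) ⟩
    x + 0# ≈⟨ identityʳ x ⟩
    x      ∎

  x≤y+z⇒x-y≤z : ∀ {x y z} → x ≤ y + z → x - y ≤ z
  x≤y+z⇒x-y≤z {x} {y} {z} x≤y+z = begin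
    x - y       ≤⟨ +-mono-≤ (- y) x≤y+z ⟩
    (y + z) - y ≈⟨ xyx⁻¹≈y y z ⟩
    z           ∎

  x≤y+z⇒x-z≤y : ∀ {x y z} → x ≤ y + z → x - z ≤ y
  x≤y+z⇒x-z≤y {x} {y} {z} x≤y+z = begin
    x - z       ≤⟨ +-mono-≤ (- z) x≤y+z ⟩
    (y + z) - z ≈⟨ //-rightDividesʳ z y ⟩
    y           ∎

  y<x+y : ∀ {x} y → 0# < x → y < x + y
  y<x+y {x} y (0≤x , 0≉x) = ≤∧≉⇒< y≤x+y (λ y≈x+y → 0≉x (≈-sym (identityˡ-unique x y (≈-sym y≈x+y))))
    where
    y≤x+y : y ≤ x + y
    y≤x+y = begin
      y      ≈⟨ identityˡ y ⟨
      0# + y ≤⟨ +-mono-≤ y 0≤x ⟩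
      x + y  ∎

  ·≗× : ∀ n x → n · x ≡ n ×ᴹ x
  ·≗× zero    x = refl
  ·≗× (suc n) x = cong (x +_) (·≗× n x)

  ·-congʳ : ∀ n {x y} → x ≈ y → n · x ≈ n · y
  ·-congʳ n {x} {y} rewrite ·≗× n x | ·≗× n y = ×-congʳ n

  ·-distrib-+ : ∀ n x y → n · (x + y) ≈ n · x + n · y
  ·-distrib-+ n x y rewrite ·≗× n (x + y) | ·≗× n x | ·≗× n y = ×-distrib-+ x y n

  ·-homo-+ : ∀ m n x → (m ℕ.+ n) · x ≈ m · x + n · x
  ·-homo-+ m n x rewrite ·≗× (m ℕ.+ n) x | ·≗× m x | ·≗× n x = ×-homo-+ x m n

  ·-assoc : ∀ m n x → m · (n · x) ≈ (m ℕ.* n) · x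
  ·-assoc m n x rewrite ·≗× n x | ·≗× m (n ×ᴹ x) | ·≗× (m ℕ.* n) x = ×-assocˡ x m n

  ·-zeroʳ : ∀ n → n · 0# ≈ 0#
  ·-zeroʳ zero    = ≈-refl
  ·-zeroʳ (suc n) = ≈-trans (identityˡ (n · 0#)) (·-zeroʳ n)

  ·-neg : ∀ n x → n · (- x) ≈ - (n · x)
  ·-neg zero    x = ≈-sym ε⁻¹≈ε
  ·-neg (suc n) x = ≈-trans (∙-congˡ (·-neg n x)) (⁻¹-∙-comm x (n · x))

  ·-monoʳ-≤ : ∀ n {x y} → x ≤ y → n · x ≤ n · y
  ·-monoʳ-≤ zero    x≤y = ≤-refl
  ·-monoʳ-≤ (suc n) x≤y = +-mono-≤₂ x≤y (·-monoʳ-≤ n x≤y)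

  ·-nonneg : ∀ n {x} → 0# ≤ x → 0# ≤ n · x
  ·-nonneg n {x} 0≤x = begin
    0#     ≈⟨ ·-zeroʳ n ⟨
    n · 0# ≤⟨ ·-monoʳ-≤ n 0≤x ⟩
    n · x  ∎

module Regularity {c ℓ₁ ℓ₂} (G : OrderedAbelianGroup c ℓ₁ ℓ₂) (γ : OrderedAbelianGroup.Carrier G)
  where
  open OrderedAbelianGroup G
  open OrderedAbelianGroupProperties G

  CosetMeets : ∀ {p} → ℕ → (Carrier → Set p) → Carrier → Set (c ⊔ ℓ₁ ⊔ p)
  CosetMeets n P x = Σ Carrier λ y → Σ Carrier λ z → (x ≈ n · y + z) × P z

  Remainder≤ : ℕ → Carrier → Set ℓ₂
  Remainder≤ n z = 0# ≤ z × z ≤ n · γ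

  Remainder< : ℕ → Carrier → Set (ℓ₁ ⊔ ℓ₂)
  Remainder< n z = 0# ≤ z × z < n · γ

  private variable
    p q : Level
    P : Carrier → Set p
    Q : Carrier → Set q

  CosetMeets-self : ∀ {n x} → P x → CosetMeets n P x
  CosetMeets-self {n = n} {x} Px = 0# , x , ≈-sym (≈-trans (∙-congʳ (·-zeroʳ n)) (identityˡ x)) , Px

  CosetMeets-shift : ∀ {n x u w} → x ≈ n · u + w → CosetMeets n P w → CosetMeets n P x
  CosetMeets-shift {n = n} {x} {u} {w} x≈nu+w (y , z , w≈ny+z , Pz) = u + y , z , x≈n[u+y]+z , Pz
    where
    x≈n[u+y]+z : x ≈ n · (u + y) + z
    x≈n[u+y]+z = begin-equality
      x                   ≈⟨ x≈nu+w ⟩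
      n · u + w           ≈⟨ ∙-congˡ w≈ny+z ⟩
      n · u + (n · y + z) ≈⟨ assoc (n · u) (n · y) z ⟨
      n · u + n · y + z   ≈⟨ ∙-congʳ (·-distrib-+ n u y) ⟨
      n · (u + y) + z     ∎

  CosetMeets-bind : ∀ {n} → (∀ {z} → P z → CosetMeets n Q z) →
                    ∀ {x} → CosetMeets n P x → CosetMeets n Q x
  CosetMeets-bind {n = n} f (y , z , x≈ny+z , Pz) = CosetMeets-shift {n = n} x≈ny+z (f Pz)

  CosetMeets-map : ∀ {n} → (∀ {z} → P z → Q z) → ∀ {x} → CosetMeets n P x → CosetMeets n Q x
  CosetMeets-map f (y , z , x≈ny+z , Pz) = y , z , x≈ny+z , f Pz

  Conv-resp-≈ : ∀ {x y} → x ≈ y → Conv G γ x → Conv G γ y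
  Conv-resp-≈ x≈y (m , x≤mγ , -x≤mγ) = m , ≤-respˡ-≈ x≈y x≤mγ , ≤-respˡ-≈ (⁻¹-cong x≈y) -x≤mγ

  Conv-neg : ∀ {x} → Conv G γ x → Conv G γ (- x)
  Conv-neg {x} (m , x≤mγ , -x≤mγ) = m , -x≤mγ , ≤-respˡ-≈ (≈-sym (⁻¹-involutive x)) x≤mγ

  Conv-+ : ∀ {x y} → Conv G γ x → Conv G γ y → Conv G γ (x + y)
  Conv-+ {x} {y} (m , x≤mγ , -x≤mγ) (k , y≤kγ , -y≤kγ) =
    m ℕ.+ k , bound x≤mγ y≤kγ , ≤-respˡ-≈ (⁻¹-∙-comm x y) (bound -x≤mγ -y≤kγ)
    where
    bound : ∀ {u v} → u ≤ m · γ → v ≤ k · γ → u + v ≤ (m ℕ.+ k) · γ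
    bound u≤mγ v≤kγ = ≤-respʳ-≈ (≈-sym (·-homo-+ m k γ)) (+-mono-≤₂ u≤mγ v≤kγ)

  Remainder≤⇒Conv : ∀ m {z} → Remainder≤ m z → Conv G γ z
  Remainder≤⇒Conv m (0≤z , z≤mγ) = m , z≤mγ , ≤-trans (0≤x⇒-x≤0 0≤z) (≤-trans 0≤z z≤mγ)

  divisible⇒meetsConv : ∀ {n x y} → Conv G γ (x - n · y) → CosetMeets n (Conv G γ) x
  divisible⇒meetsConv {n} {x} {y} x-ny∈Conv = y , x - n · y , x≈y+[x-y] x (n · y) , x-ny∈Conv

  meetsConv⇒divisible : ∀ {n x} → CosetMeets n (Conv G γ) x → Σ Carrier λ y → Conv G γ (x - n · y)
  meetsConv⇒divisible {n} {x} (y , z , x≈ny+z , z∈Conv) = y , Conv-resp-≈ z≈x-ny z∈Conv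
    where
    z≈x-ny : z ≈ x - n · y
    z≈x-ny = begin-equality
      z                   ≈⟨ xyx⁻¹≈y (n · y) z ⟨
      (n · y + z) - n · y ≈⟨ ∙-congʳ x≈ny+z ⟨
      x - n · y           ∎

  module _ (0≤γ : 0# ≤ γ) (n' : ℕ) where
    private n = suc n'

    γ≤nγ : γ ≤ n · γ
    γ≤nγ = x≤x+y γ (·-nonneg n' 0≤γ)

    bounded⇒meetsRemainder≤ : ∀ k {w} → 0# ≤ w → w ≤ k · γ → CosetMeets n (Remainder≤ n) w
    bounded⇒meetsRemainder≤ zero 0≤w w≤0 =
      CosetMeets-self {n = n} (0≤w , ≤-trans w≤0 (·-nonneg n 0≤γ))
    bounded⇒meetsRemainder≤ (suc k) {w} 0≤w w≤γ+kγ with total w (n · γ)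
    ... | inj₁ w≤nγ = CosetMeets-self {n = n} (0≤w , w≤nγ)
    ... | inj₂ nγ≤w = CosetMeets-shift {n = n} (x≈y+[x-y] w (n · γ))
                        (bounded⇒meetsRemainder≤ k (x≤y⇒0≤y-x nγ≤w) w-nγ≤kγ)
      where
      w-nγ≤kγ : w - n · γ ≤ k · γ
      w-nγ≤kγ = begin
        w - n · γ ≤⟨ +-monoʳ-≤ w (neg-mono-≤ γ≤nγ) ⟩
        w - γ     ≤⟨ x≤y+z⇒x-y≤z w≤γ+kγ ⟩
        k · γ     ∎

    Conv⇒meetsRemainder≤ : ∀ {δ} → Conv G γ δ → CosetMeets n (Remainder≤ n) δ
    Conv⇒meetsRemainder≤ {δ} (m , δ≤a , -δ≤a) =
      CosetMeets-shift {n = n} δ≈n[-a]+[δ+na]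
        (bounded⇒meetsRemainder≤ (suc n ℕ.* m) 0≤δ+na δ+na≤[1+n]mγ)
      where
      a = m · γ
      δ≈n[-a]+[δ+na] : δ ≈ n · (- a) + (δ + n · a)
      δ≈n[-a]+[δ+na] = begin-equality
        δ                         ≈⟨ identityʳ δ ⟨
        δ + 0#                    ≈⟨ ∙-congˡ (inverseˡ (n · a)) ⟨
        δ + (- (n · a) + n · a)   ≈⟨ x∙yz≈y∙xz δ (- (n · a)) (n · a) ⟩
        - (n · a) + (δ + n · a)   ≈⟨ ∙-congʳ (·-neg n a) ⟨
        n · (- a) + (δ + n · a)   ∎
      0≤δ+na : 0# ≤ δ + n · a
      0≤δ+na = -x≤y⇒0≤x+y (≤-trans -δ≤a (x≤x+y a (·-nonneg n' (·-nonneg m 0≤γ))))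
      δ+na≤[1+n]mγ : δ + n · a ≤ (suc n ℕ.* m) · γ
      δ+na≤[1+n]mγ = begin
        δ + n · a ≤⟨ +-mono-≤ (n · a) δ≤a ⟩
        a + n · a ≈⟨ ·-assoc (suc n) m γ ⟩
        (suc n ℕ.* m) · γ ∎

    divisible⇒meetsRemainder≤ : DivisibleModConv G γ → ∀ x → CosetMeets n (Remainder≤ n) x
    divisible⇒meetsRemainder≤ div x =
      CosetMeets-bind {n = n} Conv⇒meetsRemainder≤
        (divisible⇒meetsConv {n = n} (proj₂ (div n (s≤s z≤n) x)))

  module _ (0<γ : 0# < γ) (n' : ℕ) where
    private n = suc n'

    Remainder≤⇒meetsRemainder< : ∀ {z} → Remainder≤ n z → CosetMeets n (Remainder< n) z
    Remainder≤⇒meetsRemainder< {z} (0≤z , z≤nγ) with total z (n' · γ)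
    ... | inj₁ z≤n'γ = CosetMeets-self {n = n} (0≤z , z<nγ)
      where
      z<nγ : z < n · γ
      z<nγ = begin-strict
        z      ≤⟨ z≤n'γ ⟩
        n' · γ <⟨ y<x+y (n' · γ) 0<γ ⟩
        n · γ  ∎
    ... | inj₂ n'γ≤z = e , n' · (γ - e) , z≈ne+n'[γ-e] , ·-nonneg n' (x≤y⇒0≤y-x e≤γ) , n'[γ-e]<nγ
      where
      e = z - n' · γ
      e≤γ : e ≤ γ
      e≤γ = x≤y+z⇒x-z≤y z≤nγ
      n'[γ-e]<nγ : n' · (γ - e) < n · γ
      n'[γ-e]<nγ = begin-strict
        n' · (γ - e) ≤⟨ ·-monoʳ-≤ n' (x-y≤x γ (x≤y⇒0≤y-x n'γ≤z)) ⟩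
        n' · γ       <⟨ y<x+y (n' · γ) 0<γ ⟩
        n · γ        ∎
      z≈ne+n'[γ-e] : z ≈ n · e + n' · (γ - e)
      z≈ne+n'[γ-e] = begin-equality
        z                           ≈⟨ //-rightDividesˡ (n' · γ) z ⟨
        e + n' · γ                  ≈⟨ ∙-congˡ (·-congʳ n' (x≈y+[x-y] γ e)) ⟩
        e + n' · (e + (γ - e))      ≈⟨ ∙-congˡ (·-distrib-+ n' e (γ - e)) ⟩
        e + (n' · e + n' · (γ - e)) ≈⟨ assoc e (n' · e) (n' · (γ - e)) ⟨
        n · e + n' · (γ - e)        ∎

    divisible⇒meetsRemainder< : DivisibleModConv G γ → ∀ x → CosetMeets n (Remainder< n) x
    divisible⇒meetsRemainder< div x =
      CosetMeets-bind {n = n} Remainder≤⇒meetsRemainder<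
        (divisible⇒meetsRemainder≤ (proj₁ 0<γ) n' div x)

  divisible⇒regular : 0# < γ → DivisibleModConv G γ → RegularAbove G γ
  divisible⇒regular 0<γ div (suc n') _ x _ = divisible⇒meetsRemainder< 0<γ n' div x

  divisible-neg : ∀ {n x y} → Conv G γ (- x - n · y) → Conv G γ (x - n · (- y))
  divisible-neg {n} {x} {y} -x-ny∈Conv = Conv-resp-≈ -[-x-ny]≈x-n[-y] (Conv-neg -x-ny∈Conv)
    where
    -[-x-ny]≈x-n[-y] : - (- x - n · y) ≈ x - n · (- y)
    -[-x-ny]≈x-n[-y] = begin-equality
      - (- x - n · y)     ≈⟨ ⁻¹-∙-comm (- x) (- (n · y)) ⟨
      - - x + - - (n · y) ≈⟨ ∙-congʳ (⁻¹-involutive x) ⟩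
      x + - - (n · y)     ≈⟨ ∙-congˡ (⁻¹-cong (·-neg n y)) ⟨
      x - n · (- y)       ∎

  module _ (0<γ : 0# < γ) (reg : RegularAbove G γ) where

    regular⇒divisible-nonneg : ∀ n → 2 ℕ.≤ n → ∀ {x} → 0# ≤ x → Σ Carrier λ y → Conv G γ (x - n · y)
    regular⇒divisible-nonneg n 2≤n {x} 0≤x = divisible (reg n 2≤n (a + x) nγ<a+x)
      where
      a = suc n · γ
      nγ<a+x : n · γ < a + x
      nγ<a+x = begin-strict
        n · γ <⟨ y<x+y (n · γ) 0<γ ⟩
        a     ≤⟨ x≤x+y a 0≤x ⟩
        a + x ∎
      divisible : CosetMeets n (Remainder< n) (a + x) → Σ Carrier λ y → Conv G γ (x - n · y)
      divisible (y , z , a+x≈ny+z , 0≤z , z≤nγ , _) =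
        meetsConv⇒divisible {n = n}
          (y , - a + z , x≈ny+[-a+z] , Conv-+ (Conv-neg a∈Conv) (Remainder≤⇒Conv n (0≤z , z≤nγ)))
        where
        a∈Conv : Conv G γ a
        a∈Conv = Remainder≤⇒Conv (suc n) (·-nonneg (suc n) (proj₁ 0<γ) , ≤-refl)
        x≈ny+[-a+z] : x ≈ n · y + (- a + z)
        x≈ny+[-a+z] = begin-equality
          x                 ≈⟨ \\-leftDividesʳ a x ⟨
          - a + (a + x)     ≈⟨ ∙-congˡ a+x≈ny+z ⟩
          - a + (n · y + z) ≈⟨ x∙yz≈y∙xz (- a) (n · y) z ⟩
          n · y + (- a + z) ∎

    regular⇒divisible : DivisibleModConv G γ
    regular⇒divisible 1 _ x = meetsConv⇒divisible {n = 1}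
      (x , 0# , ≈-sym (≈-trans (identityʳ (x + 0#)) (identityʳ x)) ,
       Remainder≤⇒Conv 0 (≤-refl , ≤-refl))
    regular⇒divisible n@(suc (suc _)) _ x with total 0# x
    ... | inj₁ 0≤x = regular⇒divisible-nonneg n (s≤s (s≤s z≤n)) 0≤x
    ... | inj₂ x≤0 = let y , -x-ny∈Conv = regular⇒divisible-nonneg n (s≤s (s≤s z≤n)) (x≤0⇒0≤-x x≤0)
                     in - y , divisible-neg {n = n} -x-ny∈Conv

_·ₜ_ : ∀ {k} → ℕ → Term k → Term k
zero  ·ₜ t = zer
suc n ·ₜ t = t ⊕ (n ·ₜ t)

remainder≤-formula : ℕ → Formula 3
remainder≤-formula n = (x ≐ ((n ·ₜ y) ⊕ z)) ∧f ((zer ≼ z) ∧f (z ≼ (n ·ₜ cst)))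
  where
  x y z : Term 3
  x = var (suc (suc zero))
  y = var (suc zero)
  z = var zero

remainder≤-sentence : ℕ → Formula 0
remainder≤-sentence n = ∀f (∃f (∃f (remainder≤-formula n)))

module Semantics {c ℓ₁ ℓ₂} (G : OrderedAbelianGroup c ℓ₁ ℓ₂) (γ : OrderedAbelianGroup.Carrier G)
  where
  open OrderedAbelianGroup G
  open Regularity G γ using (CosetMeets; Remainder≤)

  ⟦·ₜ⟧ : ∀ {k} n (t : Term k) ρ → ⟦_⟧t G γ (n ·ₜ t) ρ ≡ n · ⟦_⟧t G γ t ρ
  ⟦·ₜ⟧ zero    t ρ = refl
  ⟦·ₜ⟧ (suc n) t ρ = cong (⟦_⟧t G γ t ρ +_) (⟦·ₜ⟧ n t ρ)

  Sat-remainder≤-formula : ∀ n {ρ} x y z →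
    Sat G γ (remainder≤-formula n) (extend z (extend y (extend x ρ))) ⇔
    ((x ≈ n · y + z) × Remainder≤ n z)
  Sat-remainder≤-formula n {ρ} x y z
    rewrite ⟦·ₜ⟧ n (var (suc zero)) (extend z (extend y (extend x ρ)))
          | ⟦·ₜ⟧ n cst (extend z (extend y (extend x ρ)))
    = mk⇔ (λ (lift x≈ny+z , lift 0≤z , lift z≤nγ) → x≈ny+z , 0≤z , z≤nγ)
          (λ (x≈ny+z , 0≤z , z≤nγ) → lift x≈ny+z , lift 0≤z , lift z≤nγ)

  Sat-remainder≤-sentence : ∀ n ρ →
    Sat G γ (remainder≤-sentence n) ρ ⇔ (∀ x → CosetMeets n (Remainder≤ n) x)
  Sat-remainder≤-sentence n ρ = mk⇔ to from
    where
    to : Sat G γ (remainder≤-sentence n) ρ → ∀ x → CosetMeets n (Remainder≤ n) x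
    to sat x = let y , z , s = sat x
               in y , z , Equivalence.to (Sat-remainder≤-formula n x y z) s
    from : (∀ x → CosetMeets n (Remainder≤ n) x) → Sat G γ (remainder≤-sentence n) ρ
    from rem x = let y , z , r = rem x
                 in y , z , Equivalence.from (Sat-remainder≤-formula n x y z) r

ElementaryExtension-refl : ∀ {c ℓ₁ ℓ₂} {G : OrderedAbelianGroup c ℓ₁ ℓ₂} {γ} →
                           ElementaryExtension G γ G γ
ElementaryExtension-refl = record
  { embed = λ x → x ; preserve = λ _ _ sat → sat ; reflect = λ _ _ sat → sat }

module _ {c ℓ₁ ℓ₂ c* ℓ₁* ℓ₂*} {G : OrderedAbelianGroup c ℓ₁ ℓ₂} {γ : OrderedAbelianGroup.Carrier G}
         {G* : OrderedAbelianGroup c* ℓ₁* ℓ₂*} {γ* : OrderedAbelianGroup.Carrier G*}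
         (ext : ElementaryExtension G γ G* γ*) where
  private
    module R  = Regularity G γ
    module R* = Regularity G* γ*
  open ElementaryExtension ext

  remainder≤-transfer : ∀ n → (∀ x → R.CosetMeets n (R.Remainder≤ n) x) →
                        ∀ x* → R*.CosetMeets n (R*.Remainder≤ n) x*
  remainder≤-transfer n rem = Equivalence.to (Semantics.Sat-remainder≤-sentence G* γ* n (embed ∘ ρ∅))
    (preserve (remainder≤-sentence n) ρ∅
      (Equivalence.from (Semantics.Sat-remainder≤-sentence G γ n ρ∅) rem))
    where
    ρ∅ : Fin 0 → OrderedAbelianGroup.Carrier G
    ρ∅ ()

divisible⇒allElemExtDivisible : ∀ {c ℓ₁ ℓ₂} (G : OrderedAbelianGroup c ℓ₁ ℓ₂)
  (γ : OrderedAbelianGroup.Carrier G) → OrderedAbelianGroup._≤_ G (OrderedAbelianGroup.0# G) γ →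
  DivisibleModConv G γ → AllElemExtDivisible G γ
divisible⇒allElemExtDivisible G γ 0≤γ div G* γ* ext (suc n') _ x* =
  R*.meetsConv⇒divisible {n = suc n'}
    (R*.CosetMeets-map {n = suc n'} (R*.Remainder≤⇒Conv (suc n'))
      (remainder≤-transfer ext (suc n') (R.divisible⇒meetsRemainder≤ 0≤γ n' div) x*))
  where
  module R  = Regularity G γ
  module R* = Regularity G* γ*

proposition4p18 : ∀ {c ℓ₁ ℓ₂} (G : OrderedAbelianGroup c ℓ₁ ℓ₂)
    (γ : OrderedAbelianGroup.Carrier G) →
    OrderedAbelianGroup._<_ G (OrderedAbelianGroup.0# G) γ →
    TFAE (RegularAbove G γ) (DivisibleModConv G γ) (AllElemExtDivisible G γ)
proposition4p18 G γ 0<γ = record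
  { i⇒ii   = regular⇒divisible 0<γ
  ; ii⇒i   = divisible⇒regular 0<γ
  ; ii⇒iii = divisible⇒allElemExtDivisible G γ (proj₁ 0<γ)
  ; iii⇒ii = λ allElemExtDivisible → allElemExtDivisible G γ ElementaryExtension-refl
  }
  where open Regularity G γ using (regular⇒divisible; divisible⇒regular)
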